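{- Let $\{a,b,c\}$ be a rational Diophantine triple such that $a^2+1$ and $b^2+1$ are rational squares. Write $ab+1=r^2$, $ac+1=s^2$, $bc+1=t^2$, $a^2+1=u^2$, $b^2+1=v^2$ with $r,s,t,u,v\in\mathbb{Q}$. Consider the elliptic curve $E_{a,b,c}: y^2=(x+ab)(x+ac)(x+bc)$ over $\mathbb{Q}$ and its rational points $$P=[0,abc],\quad S=[1,rst],\quad A=[a\cdot abc,\ abc\cdot rsu],\quad B=[b\cdot abc,\ abc\cdot rtv].$$ Then: (a) $r_4(a,a,b,c)=0$ if and only if $A=\pm P\pm S$ for some choice of signs; (b) $r_5(a,a,b,b,c)=0$ if and only if $A\pm B\pm S=\mathcal{O}$ for some choice of signs, where $\mathcal{O}$ is the point at infinity (neutral element of the group law).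
   Context: A rational Diophantine triple is a set of three distinct nonzero rationals such that the product of any two of them plus $1$ is a rational square. The polynomials are $$r_4(a,b,c,d)=(a+b-c-d)^2-4(ab+1)(cd+1),$$ $$r_5(a,b,c,d,e)=(abcde+2abc+a+b+c-d-e)^2-4(ab+1)(ac+1)(bc+1)(de+1).$$ -}

module Defs where

open import Data.Bool using (Bool; true; false)
open import Data.Rational using (ℚ; 0ℚ; 1ℚ; _+_; _*_; _-_; -_; 1/_; NonZero)
open import Data.Rational.Properties using (_≟_)
open import Data.Rational using (≢-nonZero)
open import Relation.Nullary using (yes; no)
open import Relation.Binary.PropositionalEquality using (_≡_)

-- Reciprocal, totalised by 0 at 0 (only ever used on nonzero arguments below).
inv : ℚ → ℚ
inv q with q ≟ 0ℚ
... | yes _ = 0ℚ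
... | no q≢0 = 1/_ q {{≢-nonZero q≢0}}

sq : ℚ → ℚ
sq x = x * x

2ℚ 3ℚ 4ℚ : ℚ
2ℚ = 1ℚ + 1ℚ
3ℚ = 2ℚ + 1ℚ
4ℚ = 2ℚ + 2ℚ

r4 : ℚ → ℚ → ℚ → ℚ → ℚ
r4 a b c d = sq (a + b - c - d) - 4ℚ * ((a * b + 1ℚ) * (c * d + 1ℚ))

r5 : ℚ → ℚ → ℚ → ℚ → ℚ → ℚ
r5 a b c d e =
  sq (a * b * c * d * e + 2ℚ * (a * b * c) + a + b + c - d - e)
  - 4ℚ * ((a * b + 1ℚ) * (a * c + 1ℚ) * (b * c + 1ℚ) * (d * e + 1ℚ))

data Point : Set where
  O   : Point
  aff : ℚ → ℚ → Point

-- Curve E : y² = x³ + a₂ x² + a₄ x + a₆ ; the chord-tangent group law only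
-- depends on a₂ and a₄ (a₁ = a₃ = 0).
negP : Point → Point
negP O = O
negP (aff x y) = aff x (- y)

addW : ℚ → ℚ → Point → Point → Point
addW a₂ a₄ O Q = Q
addW a₂ a₄ (aff x₁ y₁) O = aff x₁ y₁
addW a₂ a₄ (aff x₁ y₁) (aff x₂ y₂) with x₁ ≟ x₂
... | no _ = third ((y₂ - y₁) * inv (x₂ - x₁))
  where
  third : ℚ → Point
  third l = let x₃ = sq l - a₂ - x₁ - x₂ in aff x₃ (- (l * (x₃ - x₁) + y₁))
... | yes _ with (y₁ + y₂) ≟ 0ℚ
...   | yes _ = O
...   | no _ = third ((3ℚ * sq x₁ + 2ℚ * a₂ * x₁ + a₄) * inv (2ℚ * y₁))
  where
  third : ℚ → Point
  third l = let x₃ = sq l - a₂ - x₁ - x₂ in aff x₃ (- (l * (x₃ - x₁) + y₁))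

-- The curve E_{a,b,c} : y² = (x + ab)(x + ac)(x + bc), i.e.
-- a₂ = ab + ac + bc, a₄ = ab·ac + ab·bc + ac·bc.
addE : ℚ → ℚ → ℚ → Point → Point → Point
addE a b c = addW (a * b + a * c + b * c)
                  (a * b * (a * c) + a * b * (b * c) + a * c * (b * c))

sgn : Bool → Point → Point
sgn true  P = P
sgn false P = negP P

-- P ± S and A ± B are chord sums of points with distinct x-coordinates, and
-- a point of the curve is determined up to sign by its x-coordinate.  Since
-- ±P ± S = ±(P ± S), the equation A = ±P ± S says x(P ± S) = x_A, and
-- x(P ± S) − x_A = abc (D ∓ W) with D = b + c + 2abc, W = 2rst, while
-- r₄(a,a,b,c) = D² − W².  Likewise A ± B ± S = O says x(A ± B) = x_S = 1, and
-- (b − a)² (x(A ± B) − 1) = H±, whose product H₊ H₋ is (a − b)² r₅(a,a,b,b,c).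
module Submission where

open import Defs
open import Data.Bool using (Bool; true; false; not)
open import Data.Empty using (⊥-elim)
open import Data.Product using (_×_; ∃; ∃₂; _,_; proj₁)
open import Data.Product.Function.Dependent.Propositional using (congˡ)
open import Data.Rational using (ℚ; 0ℚ; 1ℚ; _+_; _*_; _-_; -_; ≢-nonZero)
import Data.Rational.Properties as ℚₚ
open ℚₚ using (_≟_)
open import Data.Rational.Solver using (module +-*-Solver)
open +-*-Solver
open import Data.Sum using (_⊎_; inj₁; inj₂; [_,_]′)
open import Data.Unit using (⊤)
open import Function.Bundles using (_⇔_; mk⇔; Equivalence)
open import Function using (_∘_; id)
open import Function.Nary.NonDependent using (congₙ)
import Function.Properties.Equivalence as ⇔
open import Function.Related.Propositional using (module EquationalReasoning)
open import Relation.Nullary using (yes; no)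
open import Relation.Binary.PropositionalEquality
  using (_≡_; _≢_; refl; sym; trans; cong; cong₂; subst; module ≡-Reasoning)
open import Algebra.Properties.Group ℚₚ.+-0-group
  using (⁻¹-involutive; x∙y⁻¹≈ε⇒x≈y; x≈y⇒x∙y⁻¹≈ε)
open import Algebra.Apartness.Properties.HeytingCommutativeRing ℚₚ.heytingCommutativeRing
  using (x#0y#0→xy#0)

open Equivalence using (to; from)

p-q≡0⇔p≡q : ∀ {p q} → p - q ≡ 0ℚ ⇔ p ≡ q
p-q≡0⇔p≡q {p} {q} = mk⇔ (x∙y⁻¹≈ε⇒x≈y p q) x≈y⇒x∙y⁻¹≈ε

p*q≡0⇒p≡0∨q≡0 : ∀ {p q} → p * q ≡ 0ℚ → p ≡ 0ℚ ⊎ q ≡ 0ℚ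
p*q≡0⇒p≡0∨q≡0 {p} {q} pq≡0 with p ≟ 0ℚ | q ≟ 0ℚ
... | yes p≡0 | _       = inj₁ p≡0
... | no _    | yes q≡0 = inj₂ q≡0
... | no p≢0  | no q≢0  = ⊥-elim (x#0y#0→xy#0 p≢0 q≢0 pq≡0)

k*p≡0⇔p≡0 : ∀ {k p} → k ≢ 0ℚ → k * p ≡ 0ℚ ⇔ p ≡ 0ℚ
k*p≡0⇔p≡0 {k} {p} k≢0 = mk⇔
  (λ kp≡0 → [ ⊥-elim ∘ k≢0 , id ]′ (p*q≡0⇒p≡0∨q≡0 kp≡0))
  (λ p≡0 → trans (cong (k *_) p≡0) (ℚₚ.*-zeroʳ k))

k*[p-q]≡z⇒p≡q⇔z≡0 : ∀ {k p q z} → k ≢ 0ℚ → k * (p - q) ≡ z → p ≡ q ⇔ z ≡ 0ℚ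
k*[p-q]≡z⇒p≡q⇔z≡0 {k} {p} {q} {z} k≢0 refl = begin
  p ≡ q               ∼⟨ ⇔.sym p-q≡0⇔p≡q ⟩
  p - q ≡ 0ℚ          ∼⟨ ⇔.sym (k*p≡0⇔p≡0 k≢0) ⟩
  k * (p - q) ≡ 0ℚ    ∎
  where open EquationalReasoning

*-cancelˡ-≡ : ∀ {k p q} → k ≢ 0ℚ → k * p ≡ k * q → p ≡ q
*-cancelˡ-≡ {k} {p} {q} k≢0 kp≡kq =
  from (k*[p-q]≡z⇒p≡q⇔z≡0 k≢0 (solve 3 (λ k p q → k :* (p :- q) := k :* p :- k :* q) refl k p q))
       (from p-q≡0⇔p≡q kp≡kq)

p≢q⇒q-p≢0 : ∀ {p q} → p ≢ q → q - p ≢ 0ℚ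
p≢q⇒q-p≢0 p≢q = p≢q ∘ sym ∘ to p-q≡0⇔p≡q

inv-inverseˡ : ∀ {p} → p ≢ 0ℚ → inv p * p ≡ 1ℚ
inv-inverseˡ {p} p≢0 with p ≟ 0ℚ
... | yes p≡0 = ⊥-elim (p≢0 p≡0)
... | no p≢0′ = ℚₚ.*-inverseˡ p {{≢-nonZero p≢0′}}

square-of-product : ∀ p q w {P Q W} → P ≡ p * p → Q ≡ q * q → W ≡ w * w →
                    (p * q * w) * (p * q * w) ≡ P * Q * W
square-of-product p q w refl refl refl =
  solve 3 (λ p q w → (p :* q :* w) :* (p :* q :* w) := (p :* p) :* (q :* q) :* (w :* w)) refl p q w

signed : Bool → ℚ → ℚ
signed true  p = p
signed false p = - p

sgn-aff : ∀ ε x y → sgn ε (aff x y) ≡ aff x (signed ε y)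
sgn-aff true  x y = refl
sgn-aff false x y = refl

signed-square : ∀ ε p → signed ε p * signed ε p ≡ p * p
signed-square true  p = refl
signed-square false p = solve 1 (λ p → (:- p) :* (:- p) := p :* p) refl p

signed-*ʳ : ∀ ε k p → signed ε (k * p) ≡ k * signed ε p
signed-*ʳ true  k p = refl
signed-*ʳ false k p = ℚₚ.neg-distribʳ-* k p

signed+signed-not : ∀ ε p → signed ε p + signed (not ε) p ≡ 0ℚ
signed+signed-not true  p = ℚₚ.+-inverseʳ p
signed+signed-not false p = ℚₚ.+-inverseˡ p

p*p≡q*q⇔p≡±q : ∀ {p q} → p * p ≡ q * q ⇔ ∃ λ ε → p ≡ signed ε q
p*p≡q*q⇔p≡±q {p} {q} = mk⇔ roots (λ { (ε , refl) → signed-square ε q })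
  where
  roots : p * p ≡ q * q → ∃ λ ε → p ≡ signed ε q
  roots p²≡q² = [ (λ p-q≡0 → true , to p-q≡0⇔p≡q p-q≡0)
                 , (λ p+q≡0 → false , to p-q≡0⇔p≡q (trans (solve 2 (λ p q → p :- (:- q) := p :+ q) refl p q) p+q≡0))
                 ]′ (p*q≡0⇒p≡0∨q≡0 (trans (solve 2 (λ p q → (p :- q) :* (p :+ q) := p :* p :- q :* q) refl p q)
                                           (from p-q≡0⇔p≡q p²≡q²)))

h⁺*h⁻≡0⇔∃h≡0 : (h : Bool → ℚ) → h true * h false ≡ 0ℚ ⇔ ∃ λ σ → h σ ≡ 0ℚ
h⁺*h⁻≡0⇔∃h≡0 h = mk⇔ factor vanish
  where
  factor : h true * h false ≡ 0ℚ → ∃ λ σ → h σ ≡ 0ℚ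
  factor h⁺h⁻≡0 = [ true ,_ , false ,_ ]′ (p*q≡0⇒p≡0∨q≡0 h⁺h⁻≡0)
  vanish : (∃ λ σ → h σ ≡ 0ℚ) → h true * h false ≡ 0ℚ
  vanish (true  , h⁺≡0) = trans (cong (_* h false) h⁺≡0) (ℚₚ.*-zeroˡ (h false))
  vanish (false , h⁻≡0) = trans (cong (h true *_) h⁻≡0) (ℚₚ.*-zeroʳ (h true))

module Weierstrass (a₂ a₄ a₆ : ℚ) where

  rhs : ℚ → ℚ
  rhs x = x * x * x + a₂ * x * x + a₄ * x + a₆

  OnCurve : Point → Set
  OnCurve O         = ⊤
  OnCurve (aff x y) = y * y ≡ rhs x

  infixl 6 _⊕_
  _⊕_ : Point → Point → Point
  _⊕_ = addW a₂ a₄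

  slope : ℚ → ℚ → ℚ → ℚ → ℚ
  slope x₁ y₁ x₂ y₂ = (y₂ - y₁) * inv (x₂ - x₁)

  chordX : ℚ → ℚ → ℚ → ℚ
  chordX l x₁ x₂ = sq l - a₂ - x₁ - x₂

  -- The negated third intersection of the curve with the line of slope l
  -- through (x₁, y₁), when that line meets the curve again at abscissa x₂.
  chord : ℚ → ℚ → ℚ → ℚ → Point
  chord l x₁ y₁ x₂ = aff (chordX l x₁ x₂) (- (l * (chordX l x₁ x₂ - x₁) + y₁))

  ⊕-chord : ∀ {x₁ y₁ x₂ y₂} → x₁ ≢ x₂ →
            aff x₁ y₁ ⊕ aff x₂ y₂ ≡ chord (slope x₁ y₁ x₂ y₂) x₁ y₁ x₂
  ⊕-chord {x₁} {_} {x₂} x₁≢x₂ with x₁ ≟ x₂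
  ... | no _      = refl
  ... | yes x₁≡x₂ = ⊥-elim (x₁≢x₂ x₁≡x₂)

  slope-* : ∀ x₁ y₁ x₂ y₂ → x₁ ≢ x₂ → slope x₁ y₁ x₂ y₂ * (x₂ - x₁) ≡ y₂ - y₁
  slope-* x₁ y₁ x₂ y₂ x₁≢x₂ = begin
    (y₂ - y₁) * inv (x₂ - x₁) * (x₂ - x₁)   ≡⟨ ℚₚ.*-assoc (y₂ - y₁) _ _ ⟩
    (y₂ - y₁) * (inv (x₂ - x₁) * (x₂ - x₁)) ≡⟨ cong ((y₂ - y₁) *_) (inv-inverseˡ (p≢q⇒q-p≢0 x₁≢x₂)) ⟩
    (y₂ - y₁) * 1ℚ                          ≡⟨ ℚₚ.*-identityʳ (y₂ - y₁) ⟩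
    y₂ - y₁                                 ∎
    where open ≡-Reasoning

  -- rhs x − (y₁ + l (x − x₁))² is a monic cubic with x²-coefficient a₂ − l²;
  -- vanishing at x₁ and x₂, it also vanishes at x₃ = chordX l x₁ x₂, and
  -- the identity used below is the interpolation form of this fact.
  chord-onCurve : ∀ {l x₁ y₁ x₂ y₂} → x₁ ≢ x₂ → l * (x₂ - x₁) ≡ y₂ - y₁ →
                  OnCurve (aff x₁ y₁) → OnCurve (aff x₂ y₂) → OnCurve (chord l x₁ y₁ x₂)
  chord-onCurve {l} {x₁} {y₁} {x₂} {y₂} x₁≢x₂ l·Δ≡ on₁ on₂ =
    sym (to p-q≡0⇔p≡q (to (k*p≡0⇔p≡0 (p≢q⇒q-p≢0 x₁≢x₂)) vanish))
    where
    open ≡-Reasoning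
    x₃ y₃ : ℚ
    x₃ = chordX l x₁ x₂
    y₃ = - (l * (x₃ - x₁) + y₁)
    line≡y₂ : y₁ + l * (x₂ - x₁) ≡ y₂
    line≡y₂ = trans (cong (y₁ +_) l·Δ≡) (solve 2 (λ y₁ y₂ → y₁ :+ (y₂ :- y₁) := y₂) refl y₁ y₂)
    g₁≡0 : rhs x₁ - y₁ * y₁ ≡ 0ℚ
    g₁≡0 = from p-q≡0⇔p≡q (sym on₁)
    g₂≡0 : rhs x₂ - (y₁ + l * (x₂ - x₁)) * (y₁ + l * (x₂ - x₁)) ≡ 0ℚ
    g₂≡0 = from p-q≡0⇔p≡q (trans (sym on₂) (cong (λ y → y * y) (sym line≡y₂)))
    vanish : (x₂ - x₁) * (rhs x₃ - y₃ * y₃) ≡ 0ℚ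
    vanish = begin
      (x₂ - x₁) * (rhs x₃ - y₃ * y₃)
        ≡⟨ solve 7 (λ l x₁ x₂ y₁ a₂ a₄ a₆ →
             let f  = λ x → x :* x :* x :+ a₂ :* x :* x :+ a₄ :* x :+ a₆
                 x₃ = l :* l :- a₂ :- x₁ :- x₂
                 y₃ = :- (l :* (x₃ :- x₁) :+ y₁)
                 y  = y₁ :+ l :* (x₂ :- x₁)
             in (x₂ :- x₁) :* (f x₃ :- y₃ :* y₃)
                := (x₃ :- x₁) :* (f x₂ :- y :* y) :- (x₃ :- x₂) :* (f x₁ :- y₁ :* y₁))
             refl l x₁ x₂ y₁ a₂ a₄ a₆ ⟩
      (x₃ - x₁) * (rhs x₂ - (y₁ + l * (x₂ - x₁)) * (y₁ + l * (x₂ - x₁)))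
        - (x₃ - x₂) * (rhs x₁ - y₁ * y₁)
        ≡⟨ cong₂ (λ g₂ g₁ → (x₃ - x₁) * g₂ - (x₃ - x₂) * g₁) g₂≡0 g₁≡0 ⟩
      (x₃ - x₁) * 0ℚ - (x₃ - x₂) * 0ℚ
        ≡⟨ solve 2 (λ p q → p :* con 0ℚ :- q :* con 0ℚ := con 0ℚ) refl (x₃ - x₁) (x₃ - x₂) ⟩
      0ℚ ∎

  chord-neg : ∀ l x₁ y₁ x₂ → chord (- l) x₁ (- y₁) x₂ ≡ negP (chord l x₁ y₁ x₂)
  chord-neg l x₁ y₁ x₂ = cong₂ aff
    (solve 4 (λ l x₁ x₂ a₂ → (:- l) :* (:- l) :- a₂ :- x₁ :- x₂ := l :* l :- a₂ :- x₁ :- x₂)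
       refl l x₁ x₂ a₂)
    (solve 5 (λ l x₁ y₁ x₂ a₂ →
        :- ((:- l) :* (((:- l) :* (:- l) :- a₂ :- x₁ :- x₂) :- x₁) :+ (:- y₁))
        := :- (:- (l :* ((l :* l :- a₂ :- x₁ :- x₂) :- x₁) :+ y₁)))
       refl l x₁ y₁ x₂ a₂)

  ⊕-negP : ∀ {x₁ y₁ x₂ y₂} → x₁ ≢ x₂ →
           negP (aff x₁ y₁) ⊕ negP (aff x₂ y₂) ≡ negP (aff x₁ y₁ ⊕ aff x₂ y₂)
  ⊕-negP {x₁} {y₁} {x₂} {y₂} x₁≢x₂ = begin
    aff x₁ (- y₁) ⊕ aff x₂ (- y₂)                       ≡⟨ ⊕-chord x₁≢x₂ ⟩
    chord (slope x₁ (- y₁) x₂ (- y₂)) x₁ (- y₁) x₂      ≡⟨ cong (λ l → chord l x₁ (- y₁) x₂) slope-neg ⟩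
    chord (- slope x₁ y₁ x₂ y₂) x₁ (- y₁) x₂            ≡⟨ chord-neg (slope x₁ y₁ x₂ y₂) x₁ y₁ x₂ ⟩
    negP (chord (slope x₁ y₁ x₂ y₂) x₁ y₁ x₂)           ≡⟨ cong negP (⊕-chord x₁≢x₂) ⟨
    negP (aff x₁ y₁ ⊕ aff x₂ y₂)                        ∎
    where
    open ≡-Reasoning
    slope-neg : slope x₁ (- y₁) x₂ (- y₂) ≡ - slope x₁ y₁ x₂ y₂
    slope-neg = solve 3 (λ y₁ y₂ i → ((:- y₂) :- (:- y₁)) :* i := :- ((y₂ :- y₁) :* i))
                  refl y₁ y₂ (inv (x₂ - x₁))

  negP-⊕-sgn : ∀ {x₁ y₁ x₂ y₂} → x₁ ≢ x₂ → ∀ ε →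
               negP (aff x₁ y₁) ⊕ sgn ε (aff x₂ y₂) ≡ negP (aff x₁ y₁ ⊕ sgn (not ε) (aff x₂ y₂))
  negP-⊕-sgn {x₁} {y₁} {x₂} {y₂} x₁≢x₂ true =
    trans (cong (λ y → aff x₁ (- y₁) ⊕ aff x₂ y) (sym (⁻¹-involutive y₂))) (⊕-negP x₁≢x₂)
  negP-⊕-sgn x₁≢x₂ false = ⊕-negP x₁≢x₂

  ∃±⊕±≡⇔∃±[⊕±]≡ : ∀ {x₁ y₁ x₂ y₂} Z → x₁ ≢ x₂ →
    (∃₂ λ ε₁ ε₂ → Z ≡ sgn ε₁ (aff x₁ y₁) ⊕ sgn ε₂ (aff x₂ y₂))
    ⇔ (∃₂ λ ε τ → sgn τ (aff x₁ y₁ ⊕ sgn ε (aff x₂ y₂)) ≡ Z)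
  ∃±⊕±≡⇔∃±[⊕±]≡ {x₁} {y₁} {x₂} {y₂} Z x₁≢x₂ = mk⇔ pull push
    where
    pull : (∃₂ λ ε₁ ε₂ → Z ≡ sgn ε₁ (aff x₁ y₁) ⊕ sgn ε₂ (aff x₂ y₂))
           → ∃₂ λ ε τ → sgn τ (aff x₁ y₁ ⊕ sgn ε (aff x₂ y₂)) ≡ Z
    pull (true  , ε₂ , Z≡) = ε₂ , true , sym Z≡
    pull (false , ε₂ , Z≡) = not ε₂ , false , sym (trans Z≡ (negP-⊕-sgn x₁≢x₂ ε₂))
    push : (∃₂ λ ε τ → sgn τ (aff x₁ y₁ ⊕ sgn ε (aff x₂ y₂)) ≡ Z)
           → ∃₂ λ ε₁ ε₂ → Z ≡ sgn ε₁ (aff x₁ y₁) ⊕ sgn ε₂ (aff x₂ y₂)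
    push (ε     , true  , ≡Z) = true , ε , sym ≡Z
    push (true  , false , ≡Z) = false , false , trans (sym ≡Z) (sym (negP-⊕-sgn x₁≢x₂ false))
    push (false , false , ≡Z) = false , true , trans (sym ≡Z) (sym (negP-⊕-sgn x₁≢x₂ true))

  ∃±≡⇔sameX : ∀ {x₁ y₁ x₂ y₂} → OnCurve (aff x₁ y₁) → OnCurve (aff x₂ y₂) →
              (∃ λ τ → sgn τ (aff x₁ y₁) ≡ aff x₂ y₂) ⇔ x₁ ≡ x₂
  ∃±≡⇔sameX {x₁} {y₁} {x₂} {y₂} on₁ on₂ = mk⇔ sameX reflect
    where
    sameX : (∃ λ τ → sgn τ (aff x₁ y₁) ≡ aff x₂ y₂) → x₁ ≡ x₂
    sameX (true  , refl) = refl
    sameX (false , refl) = refl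
    reflect : x₁ ≡ x₂ → ∃ λ τ → sgn τ (aff x₁ y₁) ≡ aff x₂ y₂
    reflect refl = reflectₑ (to p*p≡q*q⇔p≡±q (trans on₂ (sym on₁)))
      where
      reflectₑ : (∃ λ ε → y₂ ≡ signed ε y₁) → ∃ λ τ → sgn τ (aff x₁ y₁) ≡ aff x₁ y₂
      reflectₑ (ε , y₂≡±y₁) = ε , trans (sgn-aff ε x₁ y₁) (cong (aff x₁) (sym y₂≡±y₁))

  ⊕≡O⇔ : ∀ {x₁ y₁ x₂ y₂} → aff x₁ y₁ ⊕ aff x₂ y₂ ≡ O ⇔ (x₁ ≡ x₂ × y₁ + y₂ ≡ 0ℚ)
  ⊕≡O⇔ {x₁} {y₁} {x₂} {y₂} = mk⇔ opposite cancel
    where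
    opposite : aff x₁ y₁ ⊕ aff x₂ y₂ ≡ O → x₁ ≡ x₂ × y₁ + y₂ ≡ 0ℚ
    opposite ≡O with x₁ ≟ x₂
    opposite () | no _
    opposite ≡O | yes x₁≡x₂ with (y₁ + y₂) ≟ 0ℚ
    opposite ≡O | yes x₁≡x₂ | yes y₁+y₂≡0 = x₁≡x₂ , y₁+y₂≡0
    opposite () | yes _     | no _
    cancel : x₁ ≡ x₂ × y₁ + y₂ ≡ 0ℚ → aff x₁ y₁ ⊕ aff x₂ y₂ ≡ O
    cancel (x₁≡x₂ , y₁+y₂≡0) with x₁ ≟ x₂
    ... | no x₁≢x₂ = ⊥-elim (x₁≢x₂ x₁≡x₂)
    ... | yes _ with (y₁ + y₂) ≟ 0ℚ
    ...   | yes _         = refl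
    ...   | no y₁+y₂≢0 = ⊥-elim (y₁+y₂≢0 y₁+y₂≡0)

  ∃⊕±≡O⇔sameX : ∀ {x₁ y₁ x₂ y₂} → OnCurve (aff x₁ y₁) → OnCurve (aff x₂ y₂) →
                (∃ λ τ → aff x₁ y₁ ⊕ sgn τ (aff x₂ y₂) ≡ O) ⇔ x₁ ≡ x₂
  ∃⊕±≡O⇔sameX {x₁} {y₁} {x₂} {y₂} on₁ on₂ = mk⇔ sameX cancel
    where
    sameX : (∃ λ τ → aff x₁ y₁ ⊕ sgn τ (aff x₂ y₂) ≡ O) → x₁ ≡ x₂
    sameX (τ , ≡O) = proj₁ (to ⊕≡O⇔ (trans (cong (aff x₁ y₁ ⊕_) (sym (sgn-aff τ x₂ y₂))) ≡O))
    cancel : x₁ ≡ x₂ → ∃ λ τ → aff x₁ y₁ ⊕ sgn τ (aff x₂ y₂) ≡ O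
    cancel refl = cancelₑ (to p*p≡q*q⇔p≡±q (trans on₁ (sym on₂)))
      where
      cancelₑ : (∃ λ ε → y₁ ≡ signed ε y₂) → ∃ λ τ → aff x₁ y₁ ⊕ sgn τ (aff x₁ y₂) ≡ O
      cancelₑ (ε , y₁≡±y₂) = not ε , trans (cong₂ _⊕_ (cong (aff x₁) y₁≡±y₂) (sgn-aff (not ε) x₁ y₂))
                                           (from (⊕≡O⇔ {x₁} {signed ε y₂}) (refl , signed+signed-not ε y₂))

module _ (a b c r s t u v : ℚ) (a≢0 : a ≢ 0ℚ) (b≢0 : b ≢ 0ℚ) (c≢0 : c ≢ 0ℚ) (a≢b : a ≢ b)
         (r² : a * b + 1ℚ ≡ r * r) (s² : a * c + 1ℚ ≡ s * s) (t² : b * c + 1ℚ ≡ t * t)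
         (u² : a * a + 1ℚ ≡ u * u) (v² : b * b + 1ℚ ≡ v * v) where

  open Weierstrass (a * b + a * c + b * c)
                   (a * b * (a * c) + a * b * (b * c) + a * c * (b * c))
                   (a * b * (a * c) * (b * c))

  abc rst : ℚ
  abc = a * b * c
  rst = r * s * t

  abc≢0 : abc ≢ 0ℚ
  abc≢0 = x#0y#0→xy#0 (x#0y#0→xy#0 a≢0 b≢0) c≢0

  xA yA xB yB : ℚ
  xA = a * abc
  yA = abc * (r * s * u)
  xB = b * abc
  yB = abc * (r * t * v)

  P S A B : Point
  P = aff 0ℚ abc
  S = aff 1ℚ rst
  A = aff xA yA
  B = aff xB yB

  rhs-factor : ∀ x → rhs x ≡ (x + a * b) * (x + a * c) * (x + b * c)
  rhs-factor x = solve 4 (λ x a b c →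
    x :* x :* x :+ (a :* b :+ a :* c :+ b :* c) :* x :* x
      :+ (a :* b :* (a :* c) :+ a :* b :* (b :* c) :+ a :* c :* (b :* c)) :* x
      :+ a :* b :* (a :* c) :* (b :* c)
    := (x :+ a :* b) :* (x :+ a :* c) :* (x :+ b :* c)) refl x a b c

  P-on : OnCurve P
  P-on = trans (solve 3 (λ a b c → (a :* b :* c) :* (a :* b :* c)
                          := (con 0ℚ :+ a :* b) :* (con 0ℚ :+ a :* c) :* (con 0ℚ :+ b :* c)) refl a b c)
               (sym (rhs-factor 0ℚ))

  rst² : rst * rst ≡ (a * b + 1ℚ) * (a * c + 1ℚ) * (b * c + 1ℚ)
  rst² = square-of-product r s t r² s² t²

  S-on : OnCurve S
  S-on = trans rst² (trans (solve 3 (λ a b c →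
      (a :* b :+ con 1ℚ) :* (a :* c :+ con 1ℚ) :* (b :* c :+ con 1ℚ)
      := (con 1ℚ :+ a :* b) :* (con 1ℚ :+ a :* c) :* (con 1ℚ :+ b :* c)) refl a b c)
    (sym (rhs-factor 1ℚ)))

  -- xA + ab = ab (ac + 1),  xA + ac = ac (ab + 1),  xA + bc = bc (a² + 1).
  A-on : OnCurve A
  A-on = begin
    yA * yA                                        ≡⟨ solve 2 (λ k m → k :* m :* (k :* m) := k :* k :* (m :* m)) refl abc (r * s * u) ⟩
    abc * abc * ((r * s * u) * (r * s * u))        ≡⟨ cong (abc * abc *_) (square-of-product r s u r² s² u²) ⟩
    abc * abc * ((a * b + 1ℚ) * (a * c + 1ℚ) * (a * a + 1ℚ))
      ≡⟨ solve 3 (λ a b c → let x = a :* (a :* b :* c) in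
           (a :* b :* c) :* (a :* b :* c) :* ((a :* b :+ con 1ℚ) :* (a :* c :+ con 1ℚ) :* (a :* a :+ con 1ℚ))
           := (x :+ a :* b) :* (x :+ a :* c) :* (x :+ b :* c)) refl a b c ⟩
    (xA + a * b) * (xA + a * c) * (xA + b * c)     ≡⟨ rhs-factor xA ⟨
    rhs xA                                         ∎
    where open ≡-Reasoning

  B-on : OnCurve B
  B-on = begin
    yB * yB                                        ≡⟨ solve 2 (λ k m → k :* m :* (k :* m) := k :* k :* (m :* m)) refl abc (r * t * v) ⟩
    abc * abc * ((r * t * v) * (r * t * v))        ≡⟨ cong (abc * abc *_) (square-of-product r t v r² t² v²) ⟩
    abc * abc * ((a * b + 1ℚ) * (b * c + 1ℚ) * (b * b + 1ℚ))
      ≡⟨ solve 3 (λ a b c → let x = b :* (a :* b :* c) in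
           (a :* b :* c) :* (a :* b :* c) :* ((a :* b :+ con 1ℚ) :* (b :* c :+ con 1ℚ) :* (b :* b :+ con 1ℚ))
           := (x :+ a :* b) :* (x :+ a :* c) :* (x :+ b :* c)) refl a b c ⟩
    (xB + a * b) * (xB + a * c) * (xB + b * c)     ≡⟨ rhs-factor xB ⟨
    rhs xB                                         ∎
    where open ≡-Reasoning

  D W : ℚ
  D = b + c + 2ℚ * abc
  W = 2ℚ * rst

  r4≡D²-W² : r4 a a b c ≡ D * D - W * W
  r4≡D²-W² = begin
    r4 a a b c
      ≡⟨ solve 3 (λ a b c →
           (a :+ a :- b :- c) :* (a :+ a :- b :- c) :- con 4ℚ :* ((a :* a :+ con 1ℚ) :* (b :* c :+ con 1ℚ))
           := (b :+ c :+ con 2ℚ :* (a :* b :* c)) :* (b :+ c :+ con 2ℚ :* (a :* b :* c))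
              :- con 4ℚ :* ((a :* b :+ con 1ℚ) :* (a :* c :+ con 1ℚ) :* (b :* c :+ con 1ℚ))) refl a b c ⟩
    D * D - 4ℚ * ((a * b + 1ℚ) * (a * c + 1ℚ) * (b * c + 1ℚ)) ≡⟨ cong (λ z → D * D - 4ℚ * z) rst² ⟨
    D * D - 4ℚ * (rst * rst)
      ≡⟨ solve 2 (λ d q → d :* d :- con 4ℚ :* (q :* q) := d :* d :- (con 2ℚ :* q) :* (con 2ℚ :* q)) refl D rst ⟩
    D * D - W * W ∎
    where open ≡-Reasoning

  lR : Bool → ℚ
  lR ε = slope 0ℚ abc 1ℚ (signed ε rst)

  R : Bool → Point
  R ε = chord (lR ε) 0ℚ abc 1ℚ

  xR : Bool → ℚ
  xR ε = chordX (lR ε) 0ℚ 1ℚ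

  P⊕±S≡R : ∀ ε → P ⊕ sgn ε S ≡ R ε
  P⊕±S≡R ε = trans (cong (P ⊕_) (sgn-aff ε 1ℚ rst)) (⊕-chord {0ℚ} {abc} {1ℚ} {signed ε rst} (λ ()))

  R-on : ∀ ε → OnCurve (R ε)
  R-on ε = chord-onCurve {lR ε} {0ℚ} {abc} {1ℚ} {signed ε rst}
             (λ ()) (slope-* 0ℚ abc 1ℚ (signed ε rst) (λ ())) P-on (trans (signed-square ε rst) S-on)

  abc*[D-±W]≡xR-xA : ∀ ε → abc * (D - signed ε W) ≡ xR ε - xA
  abc*[D-±W]≡xR-xA ε = begin
    abc * (D - signed ε W)                              ≡⟨ cong (λ w → abc * (D - w)) (signed-*ʳ ε 2ℚ rst) ⟩
    abc * (D - 2ℚ * z)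
      ≡⟨ solve 4 (λ a b c z → let abc = a :* b :* c in
           abc :* (b :+ c :+ con 2ℚ :* abc :- con 2ℚ :* z)
           := ((z :- abc) :* (z :- abc) :- (a :* b :+ a :* c :+ b :* c) :- con 0ℚ :- con 1ℚ :- a :* abc)
              :- (z :* z :- (a :* b :+ con 1ℚ) :* (a :* c :+ con 1ℚ) :* (b :* c :+ con 1ℚ))) refl a b c z ⟩
    chordX (z - abc) 0ℚ 1ℚ - xA - (z * z - (a * b + 1ℚ) * (a * c + 1ℚ) * (b * c + 1ℚ))
      ≡⟨ cong₂ (λ l g → chordX l 0ℚ 1ℚ - xA - g) l≡ z²-rst²≡0 ⟩
    xR ε - xA - 0ℚ                                      ≡⟨ ℚₚ.+-identityʳ (xR ε - xA) ⟩
    xR ε - xA                                           ∎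
    where
    open ≡-Reasoning
    z : ℚ
    z = signed ε rst
    l≡ : z - abc ≡ slope 0ℚ abc 1ℚ z
    l≡ = trans (sym (slope-* 0ℚ abc 1ℚ z (λ ()))) (ℚₚ.*-identityʳ (slope 0ℚ abc 1ℚ z))
    z²-rst²≡0 : z * z - (a * b + 1ℚ) * (a * c + 1ℚ) * (b * c + 1ℚ) ≡ 0ℚ
    z²-rst²≡0 = from p-q≡0⇔p≡q (trans (signed-square ε rst) rst²)

  r4≡0⇔A≡±P±S : r4 a a b c ≡ 0ℚ ⇔ ∃₂ λ ε₁ ε₂ → A ≡ sgn ε₁ P ⊕ sgn ε₂ S
  r4≡0⇔A≡±P±S = begin
    r4 a a b c ≡ 0ℚ                        ≡⟨ cong (_≡ 0ℚ) r4≡D²-W² ⟩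
    D * D - W * W ≡ 0ℚ                     ∼⟨ p-q≡0⇔p≡q ⟩
    D * D ≡ W * W                          ∼⟨ p*p≡q*q⇔p≡±q ⟩
    (∃ λ ε → D ≡ signed ε W)               ∼⟨ congˡ (λ {ε} → D≡±W⇔xR≡xA ε) ⟩
    (∃ λ ε → xR ε ≡ xA)                    ∼⟨ congˡ (λ {ε} → ⇔.sym (±[P⊕±S]≡A⇔xR≡xA ε)) ⟩
    (∃₂ λ ε τ → sgn τ (P ⊕ sgn ε S) ≡ A)   ∼⟨ ⇔.sym (∃±⊕±≡⇔∃±[⊕±]≡ A (λ ())) ⟩
    (∃₂ λ ε₁ ε₂ → A ≡ sgn ε₁ P ⊕ sgn ε₂ S) ∎
    where
    open EquationalReasoning
    D≡±W⇔xR≡xA : ∀ ε → D ≡ signed ε W ⇔ xR ε ≡ xA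
    D≡±W⇔xR≡xA ε = ⇔.trans (k*[p-q]≡z⇒p≡q⇔z≡0 abc≢0 (abc*[D-±W]≡xR-xA ε)) p-q≡0⇔p≡q
    ±[P⊕±S]≡A⇔xR≡xA : ∀ ε → (∃ λ τ → sgn τ (P ⊕ sgn ε S) ≡ A) ⇔ xR ε ≡ xA
    ±[P⊕±S]≡A⇔xR≡xA ε = subst (λ X → (∃ λ τ → sgn τ X ≡ A) ⇔ xR ε ≡ xA) (sym (P⊕±S≡R ε))
                               (∃±≡⇔sameX (R-on ε) A-on)

  xA≢xB : xA ≢ xB
  xA≢xB xA≡xB = a≢b (*-cancelˡ-≡ abc≢0 (trans (ℚₚ.*-comm abc a) (trans xA≡xB (ℚₚ.*-comm b abc))))

  lQ : Bool → ℚ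
  lQ σ = slope xA yA xB (signed σ yB)

  Q : Bool → Point
  Q σ = chord (lQ σ) xA yA xB

  xQ : Bool → ℚ
  xQ σ = chordX (lQ σ) xA xB

  A⊕±B≡Q : ∀ σ → A ⊕ sgn σ B ≡ Q σ
  A⊕±B≡Q σ = trans (cong (A ⊕_) (sgn-aff σ xB yB)) (⊕-chord xA≢xB)

  Q-on : ∀ σ → OnCurve (Q σ)
  Q-on σ = chord-onCurve {lQ σ} {xA} {yA} {xB} {signed σ yB}
             xA≢xB (slope-* xA yA xB (signed σ yB) xA≢xB) A-on (trans (signed-square σ yB) B-on)

  w : Bool → ℚ
  w σ = t * signed σ v - s * u

  H : Bool → ℚ
  H σ = r * r * (w σ * w σ - (b - a) * (b - a) * (1ℚ + a * c + b * c))

  lQ*[b-a]≡r*w : ∀ σ → lQ σ * (b - a) ≡ r * w σ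
  lQ*[b-a]≡r*w σ = *-cancelˡ-≡ abc≢0 (begin
    abc * (lQ σ * (b - a))
      ≡⟨ solve 4 (λ l a b c → (a :* b :* c) :* (l :* (b :- a)) := l :* (b :* (a :* b :* c) :- a :* (a :* b :* c)))
           refl (lQ σ) a b c ⟩
    lQ σ * (xB - xA)                    ≡⟨ slope-* xA yA xB (signed σ yB) xA≢xB ⟩
    signed σ yB - yA
      ≡⟨ cong (_- yA) (trans (signed-*ʳ σ abc (r * t * v)) (cong (abc *_) (signed-*ʳ σ (r * t) v))) ⟩
    abc * (r * t * signed σ v) - abc * (r * s * u)
      ≡⟨ solve 6 (λ k r t v′ s u → k :* (r :* t :* v′) :- k :* (r :* s :* u) := k :* (r :* (t :* v′ :- s :* u)))
           refl abc r t (signed σ v) s u ⟩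
    abc * (r * w σ) ∎)
    where open ≡-Reasoning

  [b-a]²*[xQ-1]≡H : ∀ σ → (b - a) * (b - a) * (xQ σ - 1ℚ) ≡ H σ
  [b-a]²*[xQ-1]≡H σ = begin
    (b - a) * (b - a) * (xQ σ - 1ℚ)
      ≡⟨ solve 4 (λ l a b c → let abc = a :* b :* c in
           (b :- a) :* (b :- a) :* ((l :* l :- (a :* b :+ a :* c :+ b :* c) :- a :* abc :- b :* abc) :- con 1ℚ)
           := (l :* (b :- a)) :* (l :* (b :- a))
              :- (b :- a) :* (b :- a) :* ((a :* b :+ con 1ℚ) :* (con 1ℚ :+ a :* c :+ b :* c)))
           refl (lQ σ) a b c ⟩
    (lQ σ * (b - a)) * (lQ σ * (b - a)) - (b - a) * (b - a) * ((a * b + 1ℚ) * (1ℚ + a * c + b * c))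
      ≡⟨ cong₂ (λ m n → m * m - (b - a) * (b - a) * (n * (1ℚ + a * c + b * c))) (lQ*[b-a]≡r*w σ) r² ⟩
    (r * w σ) * (r * w σ) - (b - a) * (b - a) * (r * r * (1ℚ + a * c + b * c))
      ≡⟨ solve 5 (λ r w a b c →
           (r :* w) :* (r :* w) :- (b :- a) :* (b :- a) :* (r :* r :* (con 1ℚ :+ a :* c :+ b :* c))
           := r :* r :* (w :* w :- (b :- a) :* (b :- a) :* (con 1ℚ :+ a :* c :+ b :* c)))
           refl r (w σ) a b c ⟩
    H σ ∎
    where open ≡-Reasoning

  -- H₊ H₋ only involves r², s², t², u², v², which the hypotheses turn into
  -- polynomials in a, b, c.
  H⁺*H⁻≡[a-b]²*r5 : H true * H false ≡ (a - b) * (a - b) * r5 a a b b c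
  H⁺*H⁻≡[a-b]²*r5 = begin
    H true * H false
      ≡⟨ solve 8 (λ a b c r s t u v →
           let K = (b :- a) :* (b :- a) :* (con 1ℚ :+ a :* c :+ b :* c)
               w⁺ = t :* v :- s :* u
               w⁻ = t :* (:- v) :- s :* u
               F′ = λ R S T U V → R :* R :* ((T :* V :+ S :* U :- K) :* (T :* V :+ S :* U :- K)
                                            :- con 4ℚ :* (S :* U) :* (T :* V))
           in r :* r :* (w⁺ :* w⁺ :- K) :* (r :* r :* (w⁻ :* w⁻ :- K))
              := F′ (r :* r) (s :* s) (t :* t) (u :* u) (v :* v))
           refl a b c r s t u v ⟩
    F (r * r) (s * s) (t * t) (u * u) (v * v)
      ≡⟨ congₙ 5 F r² s² t² u² v² ⟨
    F (a * b + 1ℚ) (a * c + 1ℚ) (b * c + 1ℚ) (a * a + 1ℚ) (b * b + 1ℚ)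
      ≡⟨ solve 3 (λ a b c →
           let K = (b :- a) :* (b :- a) :* (con 1ℚ :+ a :* c :+ b :* c)
               e = a :* a :* b :* b :* c :+ con 2ℚ :* (a :* a :* b) :+ a :+ a :+ b :- b :- c
               F′ = λ R S T U V → R :* R :* ((T :* V :+ S :* U :- K) :* (T :* V :+ S :* U :- K)
                                            :- con 4ℚ :* (S :* U) :* (T :* V))
           in F′ (a :* b :+ con 1ℚ) (a :* c :+ con 1ℚ) (b :* c :+ con 1ℚ) (a :* a :+ con 1ℚ) (b :* b :+ con 1ℚ)
              := (a :- b) :* (a :- b)
                 :* (e :* e :- con 4ℚ :* ((a :* a :+ con 1ℚ) :* (a :* b :+ con 1ℚ) :* (a :* b :+ con 1ℚ) :* (b :* c :+ con 1ℚ))))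
           refl a b c ⟩
    (a - b) * (a - b) * r5 a a b b c ∎
    where
    open ≡-Reasoning
    F : ℚ → ℚ → ℚ → ℚ → ℚ → ℚ
    F R S T U V = R * R * ((T * V + S * U - (b - a) * (b - a) * (1ℚ + a * c + b * c))
                           * (T * V + S * U - (b - a) * (b - a) * (1ℚ + a * c + b * c))
                           - 4ℚ * (S * U) * (T * V))

  r5≡0⇔A±B±S≡O : r5 a a b b c ≡ 0ℚ ⇔ ∃₂ λ ε₁ ε₂ → A ⊕ sgn ε₁ B ⊕ sgn ε₂ S ≡ O
  r5≡0⇔A±B±S≡O = begin
    r5 a a b b c ≡ 0ℚ                              ∼⟨ ⇔.sym (k*p≡0⇔p≡0 (x#0y#0→xy#0 (p≢q⇒q-p≢0 (a≢b ∘ sym)) (p≢q⇒q-p≢0 (a≢b ∘ sym)))) ⟩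
    (a - b) * (a - b) * r5 a a b b c ≡ 0ℚ          ≡⟨ cong (_≡ 0ℚ) H⁺*H⁻≡[a-b]²*r5 ⟨
    H true * H false ≡ 0ℚ                          ∼⟨ h⁺*h⁻≡0⇔∃h≡0 H ⟩
    (∃ λ σ → H σ ≡ 0ℚ)                             ∼⟨ congˡ (λ {σ} → ⇔.sym (xQ≡1⇔H≡0 σ)) ⟩
    (∃ λ σ → xQ σ ≡ 1ℚ)                            ∼⟨ congˡ (λ {σ} → ⇔.sym (∃A⊕±B⊕±S≡O⇔xQ≡1 σ)) ⟩
    (∃₂ λ ε₁ ε₂ → A ⊕ sgn ε₁ B ⊕ sgn ε₂ S ≡ O)     ∎
    where
    open EquationalReasoning
    xQ≡1⇔H≡0 : ∀ σ → xQ σ ≡ 1ℚ ⇔ H σ ≡ 0ℚ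
    xQ≡1⇔H≡0 σ = k*[p-q]≡z⇒p≡q⇔z≡0 (x#0y#0→xy#0 (p≢q⇒q-p≢0 a≢b) (p≢q⇒q-p≢0 a≢b)) ([b-a]²*[xQ-1]≡H σ)
    ∃A⊕±B⊕±S≡O⇔xQ≡1 : ∀ σ → (∃ λ τ → A ⊕ sgn σ B ⊕ sgn τ S ≡ O) ⇔ xQ σ ≡ 1ℚ
    ∃A⊕±B⊕±S≡O⇔xQ≡1 σ = subst (λ X → (∃ λ τ → X ⊕ sgn τ S ≡ O) ⇔ xQ σ ≡ 1ℚ) (sym (A⊕±B≡Q σ))
                               (∃⊕±≡O⇔sameX (Q-on σ) S-on)

proposition1 : (a b c r s t u v : ℚ) →
    a ≢ 0ℚ → b ≢ 0ℚ → c ≢ 0ℚ → a ≢ b → a ≢ c → b ≢ c →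
    a * b + 1ℚ ≡ r * r → a * c + 1ℚ ≡ s * s → b * c + 1ℚ ≡ t * t →
    a * a + 1ℚ ≡ u * u → b * b + 1ℚ ≡ v * v →
    let abc = a * b * c
        P = aff 0ℚ abc
        S = aff 1ℚ (r * s * t)
        A = aff (a * abc) (abc * (r * s * u))
        B = aff (b * abc) (abc * (r * t * v))
        _⊕_ = addE a b c
    in (r4 a a b c ≡ 0ℚ ⇔ ∃₂ λ (ε₁ ε₂ : Bool) → A ≡ (sgn ε₁ P ⊕ sgn ε₂ S))
     × (r5 a a b b c ≡ 0ℚ ⇔ ∃₂ λ (ε₁ ε₂ : Bool) → ((A ⊕ sgn ε₁ B) ⊕ sgn ε₂ S) ≡ O)
proposition1 a b c r s t u v a≢0 b≢0 c≢0 a≢b _ _ r² s² t² u² v² =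
    r4≡0⇔A≡±P±S a b c r s t u v a≢0 b≢0 c≢0 a≢b r² s² t² u² v²
  , r5≡0⇔A±B±S≡O a b c r s t u v a≢0 b≢0 c≢0 a≢b r² s² t² u² v²
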